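{- Let $m,n \ge 3$. If there exists a perfect $2$-error-correcting code in the Cartesian product $C_m \square C_n$, then for every integer $k \ge 1$ there exists a quasi-perfect $2$-error-correcting code in $C_m \square C_n \square C_{6k}$.
   Context: All graphs are simple and connected; $d(x,y)$ is the shortest-path distance. For $n\ge 3$, $C_n$ is the cycle on $n$ vertices. The Cartesian product $G\square H$ has vertex set $V(G)\times V(H)$, with $(g_1,h_1)$ adjacent to $(g_2,h_2)$ iff either $h_1=h_2$ and $g_1g_2\in E(G)$, or $g_1=g_2$ and $h_1h_2\in E(H)$. A code is a subset $D$ of the vertex set. $D$ is $t$-error-correcting if any two distinct codewords are at distance at least $2t+1$. The covering radius of $D$ is the smallest $r$ such that every vertex is at distance at most $r$ from some codeword. A perfect $t$-error-correcting code is a $t$-error-correcting code with covering radius $t$; a quasi-perfect $t$-error-correcting code is a $t$-error-correcting code with covering radius $t+1$. -}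

module Defs where

open import Level using (0ℓ)
open import Data.Nat using (ℕ; zero; suc; _+_; _*_; _≤_)
open import Data.Fin using (Fin; toℕ)
open import Data.Product using (Σ; _×_; _,_; ∃)
open import Data.Sum using (_⊎_)
open import Relation.Nullary using (¬_)
open import Relation.Binary.PropositionalEquality using (_≡_)

record Graph : Set₁ where
  field
    V   : Set
    Adj : V → V → Set
open Graph public

data Walk (G : Graph) : V G → V G → ℕ → Set where
  here : ∀ {x} → Walk G x x 0
  step : ∀ {x y z ℓ} → Adj G x y → Walk G y z ℓ → Walk G x z (suc ℓ)

-- d(x,y) ≤ r  iff there is a walk of length ≤ r from x to y.
DistLE : (G : Graph) → V G → V G → ℕ → Set
DistLE G x y r = Σ ℕ λ ℓ → ℓ ≤ r × Walk G x y ℓ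

-- Cycle C_n on vertices 0..n-1: i ~ j iff j ≡ i+1 (mod n) or i ≡ j+1 (mod n),
-- written without mod: consecutive integers, or the wrap-around pair {n-1, 0}.
CycAdj : (n : ℕ) → Fin n → Fin n → Set
CycAdj n i j = (suc (toℕ i) ≡ toℕ j) ⊎ (suc (toℕ i) ≡ n × toℕ j ≡ 0)

Cycle : ℕ → Graph
Cycle n = record
  { V   = Fin n
  ; Adj = λ i j → CycAdj n i j ⊎ CycAdj n j i
  }

_□_ : Graph → Graph → Graph
G □ H = record
  { V   = V G × V H
  ; Adj = λ { (g₁ , h₁) (g₂ , h₂) →
              (h₁ ≡ h₂ × Adj G g₁ g₂) ⊎ (g₁ ≡ g₂ × Adj H h₁ h₂) }
  }

Code : Graph → Set₁
Code G = V G → Set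

-- t-error-correcting: distinct codewords are at distance ≥ 2t+1,
-- i.e. not at distance ≤ 2t.
ErrorCorrecting : (G : Graph) → ℕ → Code G → Set
ErrorCorrecting G t D =
  ∀ x y → D x → D y → ¬ (x ≡ y) → ¬ DistLE G x y (2 * t)

Covers : (G : Graph) → Code G → ℕ → Set
Covers G D r = ∀ v → Σ (V G) λ c → D c × DistLE G v c r

CoveringRadius : (G : Graph) → Code G → ℕ → Set
CoveringRadius G D zero    = Covers G D zero
CoveringRadius G D (suc r) = Covers G D (suc r) × ¬ Covers G D r

Perfect : (G : Graph) → ℕ → Code G → Set
Perfect G t D = ErrorCorrecting G t D × CoveringRadius G D t

QuasiPerfect : (G : Graph) → ℕ → Code G → Set
QuasiPerfect G t D = ErrorCorrecting G t D × CoveringRadius G D (suc t)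

-- Stack copies of G = C_m □ C_n along C_{6k}: layers ≡ 0 (mod 6) carry the perfect
-- code D, layers ≡ 3 carry its translate σ⁻¹D by the diagonal σ(a,b) = (a-1,b-1).
-- Reading cycle walks on ℤ, two distinct layers of the same class are ≥ 6 apart, and a
-- layer ≡ 0 is ≥ 3 from a layer ≡ 3; so a walk of length ≤ 4 between codewords in
-- layers 0 and 3 has a G-part of length ≤ 1 from x ∈ D to y with σy ∈ D, giving
-- d(x, σy) ≤ 3 with x ≠ σy because d(σy, y) = 2. Each layer is one step from a layer
-- ≡ 0 or 3, so the covering radius is ≤ 3. For c ∈ D the vertex (σc, 1) is not within
-- 2 of the code: a codeword in a layer ≡ 0 would lie within 3 of c in G (and differ from c,
-- as d(σc, c) = 2), and one in a layer ≡ 3 would force σ²c ∈ D, within 4 of c.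

module Submission where

open import Defs
open import Data.Nat using (ℕ; zero; suc; _+_; _*_; _≤_; _<_; z≤n; s≤s)
import Data.Nat.Properties as ℕ
import Data.Nat.Divisibility as ℕ
open import Data.Nat.DivMod using (_divMod_; result; _%_; [m+kn]%n≡m%n; m*n%n≡0)
open import Data.Integer as ℤ using (ℤ; +_; -_; _-_; ∣_∣)
import Data.Integer.Properties as ℤ
open import Data.Integer.Divisibility.Signed
  using (_∣_; divides; ∣-trans; ∣m∣n⇒∣m+n; ∣m∣n⇒∣m-n; ∣m⇒∣-m; ∣⇒∣ᵤ)
open import Data.Integer.Tactic.RingSolver using (solve-∀)
open import Data.Fin using (Fin; zero; suc; toℕ; fromℕ<; fromℕ; inject₁)
open import Data.Fin.Patterns using (0F; 1F; 2F; 3F; 4F; 5F)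
open import Data.Fin.Properties using (toℕ<n; toℕ-injective; toℕ-fromℕ<; toℕ-fromℕ; toℕ-inject₁)
open import Data.Product using (Σ; _×_; _,_; proj₁; proj₂)
open import Data.Sum using (_⊎_; inj₁; inj₂; swap)
open import Data.Empty using (⊥)
open import Relation.Nullary using (¬_; yes; no; contradiction)
open import Relation.Binary.PropositionalEquality

m+n≤o+p∧p≤n⇒m≤o : ∀ {m n o p} → m + n ≤ o + p → p ≤ n → m ≤ o
m+n≤o+p∧p≤n⇒m≤o {m} {_} {o} {p} m+n≤o+p p≤n =
  ℕ.+-cancelʳ-≤ p m o (ℕ.≤-trans (ℕ.+-monoʳ-≤ m p≤n) m+n≤o+p)

Undirected : Graph → Set
Undirected G = ∀ x y → Adj G x y → Adj G y x

Homomorphism : (G H : Graph) → (V G → V H) → Set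
Homomorphism G H f = ∀ x y → Adj G x y → Adj H (f x) (f y)

module _ {G : Graph} where

  _++ʷ_ : ∀ {x y z a b} → Walk G x y a → Walk G y z b → Walk G x z (a + b)
  here     ++ʷ q = q
  step e p ++ʷ q = step e (p ++ʷ q)

  reverseʷ : Undirected G → ∀ {x y ℓ} → Walk G x y ℓ → Walk G y x ℓ
  reverseʷ sym here                 = here
  reverseʷ sym (step {ℓ = ℓ} e p) =
    subst (Walk G _ _) (ℕ.+-comm ℓ 1) (reverseʷ sym p ++ʷ step (sym _ _ e) here)

  walk₀⇒≡ : ∀ {x y} → Walk G x y 0 → x ≡ y
  walk₀⇒≡ here = refl

  walk₁⇒adj : ∀ {x y} → Walk G x y 1 → Adj G x y
  walk₁⇒adj (step e here) = e

  distLE-refl : ∀ {x r} → DistLE G x x r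
  distLE-refl = 0 , z≤n , here

  adj⇒distLE : ∀ {x y} → Adj G x y → DistLE G x y 1
  adj⇒distLE e = 1 , ℕ.≤-refl , step e here

  distLE-++ : ∀ {x y z a b} → DistLE G x y a → DistLE G y z b → DistLE G x z (a + b)
  distLE-++ (ℓ , ℓ≤a , p) (ℓ′ , ℓ′≤b , q) = ℓ + ℓ′ , ℕ.+-mono-≤ ℓ≤a ℓ′≤b , p ++ʷ q

  distLE-reverse : Undirected G → ∀ {x y r} → DistLE G x y r → DistLE G y x r
  distLE-reverse sym (ℓ , ℓ≤r , p) = ℓ , ℓ≤r , reverseʷ sym p

mapʷ : ∀ {G H : Graph} (f : V G → V H) → Homomorphism G H f →
       ∀ {x y ℓ} → Walk G x y ℓ → Walk H (f x) (f y) ℓ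
mapʷ f f-hom here       = here
mapʷ f f-hom (step e p) = step (f-hom _ _ e) (mapʷ f f-hom p)

module _ {G H : Graph} where

  □-walkˡ : (h : V H) → ∀ {x y ℓ} → Walk G x y ℓ → Walk (G □ H) (x , h) (y , h) ℓ
  □-walkˡ h = mapʷ (_, h) (λ _ _ e → inj₁ (refl , e))

  □-walkʳ : (g : V G) → ∀ {x y ℓ} → Walk H x y ℓ → Walk (G □ H) (g , x) (g , y) ℓ
  □-walkʳ g = mapʷ (g ,_) (λ _ _ e → inj₂ (refl , e))

  □-undirected : Undirected G → Undirected H → Undirected (G □ H)
  □-undirected symG symH _ _ (inj₁ (h≡ , e)) = inj₁ (sym h≡ , symG _ _ e)
  □-undirected symG symH _ _ (inj₂ (g≡ , e)) = inj₂ (sym g≡ , symH _ _ e)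

  □-walk-split : ∀ {p q ℓ} → Walk (G □ H) p q ℓ →
                 Σ ℕ λ a → Σ ℕ λ b → a + b ≡ ℓ ×
                 Walk G (proj₁ p) (proj₁ q) a × Walk H (proj₂ p) (proj₂ q) b
  □-walk-split here = 0 , 0 , refl , here , here
  □-walk-split (step (inj₁ (refl , e)) w) with □-walk-split w
  ... | a , b , refl , wG , wH = suc a , b , refl , step e wG , wH
  □-walk-split (step (inj₂ (refl , e)) w) with □-walk-split w
  ... | a , b , refl , wG , wH = a , suc b , ℕ.+-suc a b , wG , step e wH

  □-split : ∀ {x y s t r} → DistLE (G □ H) (x , s) (y , t) r →
            Σ ℕ λ a → Σ ℕ λ b → a + b ≤ r × Walk G x y a × Walk H s t b
  □-split (ℓ , ℓ≤r , w) with □-walk-split w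
  ... | a , b , refl , wG , wH = a , b , ℓ≤r , wG , wH

□-hom : ∀ {G G′ H H′ : Graph} {f : V G → V G′} {g : V H → V H′} →
        Homomorphism G G′ f → Homomorphism H H′ g →
        Homomorphism (G □ H) (G′ □ H′) (λ (x , y) → f x , g y)
□-hom {g = g} f-hom g-hom _ _ (inj₁ (h≡ , e)) = inj₁ (cong g h≡ , f-hom _ _ e)
□-hom {f = f} f-hom g-hom _ _ (inj₂ (g≡ , e)) = inj₂ (cong f g≡ , g-hom _ _ e)

cycle-undirected : ∀ {N} → Undirected (Cycle N)
cycle-undirected _ _ = swap

cycAdj-functional : ∀ {N} {i j k : Fin N} → CycAdj N i j → CycAdj N i k → j ≡ k
cycAdj-functional {N} {i} {j} {k} p q = toℕ-injective (values p q)
  where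
  values : CycAdj N i j → CycAdj N i k → toℕ j ≡ toℕ k
  values (inj₁ e)        (inj₁ e′)       = trans (sym e) e′
  values (inj₁ e)        (inj₂ (e′ , _)) = contradiction (trans (sym e) e′) (ℕ.<⇒≢ (toℕ<n j))
  values (inj₂ (e , _))  (inj₁ e′)       = contradiction (trans (sym e′) e) (ℕ.<⇒≢ (toℕ<n k))
  values (inj₂ (_ , j0)) (inj₂ (_ , k0)) = trans j0 (sym k0)

cycAdj-injective : ∀ {N} {i j k : Fin N} → CycAdj N i k → CycAdj N j k → i ≡ j
cycAdj-injective {N} {i} {j} {k} p q = toℕ-injective (ℕ.suc-injective (values p q))
  where
  values : CycAdj N i k → CycAdj N j k → suc (toℕ i) ≡ suc (toℕ j)
  values (inj₁ e)        (inj₁ e′)       = trans e (sym e′)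
  values (inj₁ e)        (inj₂ (_ , k0)) = contradiction (trans e k0) ℕ.1+n≢0
  values (inj₂ (_ , k0)) (inj₁ e′)       = contradiction (trans e′ k0) ℕ.1+n≢0
  values (inj₂ (e , _))  (inj₂ (e′ , _)) = trans e (sym e′)

cycAdj-no-2-cycle : ∀ {N} {i j : Fin N} → 3 ≤ N → CycAdj N i j → CycAdj N j i → ⊥
cycAdj-no-2-cycle 3≤N p q = on-values p q 3≤N
  where
  on-values : ∀ {N a b} → (suc a ≡ b) ⊎ (suc a ≡ N × b ≡ 0) → (suc b ≡ a) ⊎ (suc b ≡ N × a ≡ 0) →
              3 ≤ N → ⊥
  on-values (inj₁ refl)          (inj₁ e)             _ = ℕ.m≢1+n+m _ (sym e)
  on-values (inj₁ refl)          (inj₂ (refl , refl)) (s≤s (s≤s ()))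
  on-values (inj₂ (refl , refl)) (inj₁ refl)          (s≤s (s≤s ()))
  on-values (inj₂ (refl , refl)) (inj₂ (_ , refl))    (s≤s ())

module _ {M : ℕ} where

  next : Fin (suc M) → Fin (suc M)
  next i with suc (toℕ i) ℕ.<? suc M
  ... | yes i+1<N = fromℕ< i+1<N
  ... | no  _     = zero

  prev : Fin (suc M) → Fin (suc M)
  prev zero    = fromℕ M
  prev (suc i) = inject₁ i

  next-spec : ∀ i → CycAdj (suc M) i (next i)
  next-spec i with suc (toℕ i) ℕ.<? suc M
  ... | yes i+1<N = inj₁ (sym (toℕ-fromℕ< i+1<N))
  ... | no  i+1≮N = inj₂ (ℕ.≤-antisym (toℕ<n i) (ℕ.≮⇒≥ i+1≮N) , refl)

  prev-spec : ∀ i → CycAdj (suc M) (prev i) i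
  prev-spec zero    = inj₂ (cong suc (toℕ-fromℕ M) , refl)
  prev-spec (suc i) = inj₁ (cong suc (toℕ-inject₁ i))

  next-prev : ∀ i → next (prev i) ≡ i
  next-prev i = cycAdj-functional (next-spec (prev i)) (prev-spec i)

  prev-next : ∀ i → prev (next i) ≡ i
  prev-next i = cycAdj-injective (prev-spec (next i)) (next-spec i)

  next-hom : Homomorphism (Cycle (suc M)) (Cycle (suc M)) next
  next-hom i _ (inj₁ a) rewrite cycAdj-functional a (next-spec i) = inj₁ (next-spec (next i))
  next-hom _ j (inj₂ a) rewrite cycAdj-functional a (next-spec j) = inj₂ (next-spec (next j))

  prev-hom : Homomorphism (Cycle (suc M)) (Cycle (suc M)) prev
  prev-hom i _ (inj₁ a) rewrite cycAdj-functional a (next-spec i) | prev-next i = inj₁ (prev-spec i)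
  prev-hom _ j (inj₂ a) rewrite cycAdj-functional a (next-spec j) | prev-next j = inj₂ (prev-spec j)

  adj-prev : ∀ i → Adj (Cycle (suc M)) i (prev i)
  adj-prev i = inj₂ (prev-spec i)

  toℕ-prev : ∀ {a} i → toℕ i ≡ suc a → toℕ (prev i) ≡ a
  toℕ-prev (suc i) e = trans (toℕ-inject₁ i) (ℕ.suc-injective e)

  prev≢ : 2 ≤ suc M → ∀ i → prev i ≢ i
  prev≢ 2≤N i prev-i≡i with subst (λ p → CycAdj (suc M) p i) prev-i≡i (prev-spec i)
  ... | inj₁ e         = ℕ.1+n≢n e
  ... | inj₂ (e , i≡0) = ℕ.<-irrefl refl (subst (2 ≤_) (trans (sym e) (cong suc i≡0)) 2≤N)

  prev²≢ : 3 ≤ suc M → ∀ i → prev (prev i) ≢ i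
  prev²≢ 3≤N i prev²-i≡i =
    cycAdj-no-2-cycle 3≤N (subst (λ p → CycAdj (suc M) p (prev i)) prev²-i≡i (prev-spec (prev i)))
                          (prev-spec i)

small-multiple≡0 : ∀ {n x} → + n ∣ x → ∣ x ∣ < n → x ≡ + 0
small-multiple≡0 {n} {x} n∣x ∣x∣<n with ∣ x ∣ in ∣x∣≡
... | zero  = ℤ.∣i∣≡0⇒i≡0 ∣x∣≡
... | suc _ = contradiction (subst (n ℕ.∣_) ∣x∣≡ (∣⇒∣ᵤ n∣x)) (ℕ.>⇒∤ ∣x∣<n)

residue-gap : ∀ {m} d z → + m ∣ (d - z) → 2 * ∣ d ∣ ≤ m → ∣ d ∣ ≤ ∣ z ∣
residue-gap {m} d z m∣d-z 2∣d∣≤m with ∣ d ∣ ℕ.≤? ∣ z ∣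
... | yes ∣d∣≤∣z∣ = ∣d∣≤∣z∣
... | no  ∣d∣≰∣z∣ = contradiction (cong ∣_∣ (ℤ.i-j≡0⇒i≡j d z d-z≡0)) (λ e → ∣d∣≰∣z∣ (ℕ.≤-reflexive e))
  where
  open ℕ.≤-Reasoning
  ∣d-z∣<m : ∣ d - z ∣ < m
  ∣d-z∣<m = begin-strict
    ∣ d - z ∣           ≤⟨ ℤ.∣i-j∣≤∣i∣+∣j∣ d z ⟩
    ∣ d ∣ + ∣ z ∣       <⟨ ℕ.+-monoʳ-< ∣ d ∣ (ℕ.≰⇒> ∣d∣≰∣z∣) ⟩
    ∣ d ∣ + ∣ d ∣       ≡⟨ cong (λ n → ∣ d ∣ + n) (ℕ.+-identityʳ ∣ d ∣) ⟨
    2 * ∣ d ∣           ≤⟨ 2∣d∣≤m ⟩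
    m                   ∎
  d-z≡0 : d - z ≡ + 0
  d-z≡0 = small-multiple≡0 m∣d-z ∣d-z∣<m

∣-difference⇒≡ : ∀ {N} {i j : Fin N} → + N ∣ (+ toℕ j - + toℕ i) → i ≡ j
∣-difference⇒≡ {N} {i} {j} N∣j-i =
  sym (toℕ-injective (ℤ.+-injective (ℤ.i-j≡0⇒i≡j _ _ (small-multiple≡0 N∣j-i ∣j-i∣<N))))
  where
  ∣j-i∣<N : ∣ + toℕ j - + toℕ i ∣ < N
  ∣j-i∣<N = subst (λ x → ∣ x ∣ < N) (sym (ℤ.m-n≡m⊖n (toℕ j) (toℕ i)))
              (ℕ.≤-<-trans (ℤ.∣m⊝n∣≤m⊔n (toℕ j) (toℕ i)) (ℕ.⊔-lub (toℕ<n j) (toℕ<n i)))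

-- z is the net displacement on ℤ of a walk of length b from i to j in C_N.
Displacement : (N b : ℕ) → Fin N → Fin N → Set
Displacement N b i j = Σ ℤ λ z → ∣ z ∣ ≤ b × + N ∣ (+ toℕ j - + toℕ i - z)

displacement-refl : ∀ {N} (i : Fin N) → Displacement N 0 i i
displacement-refl {N} i = + 0 , z≤n , divides (+ 0) (cancel (+ toℕ i) (+ N))
  where
  cancel : ∀ x n → x - x - + 0 ≡ + 0 ℤ.* n
  cancel = solve-∀

displacement-++ : ∀ {N a b} {i j k : Fin N} →
                  Displacement N a i j → Displacement N b j k → Displacement N (a + b) i k
displacement-++ {N} {i = i} {j} {k} (z₁ , ∣z₁∣≤a , N∣₁) (z₂ , ∣z₂∣≤b , N∣₂) =
  z₁ ℤ.+ z₂ ,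
  ℕ.≤-trans (ℤ.∣i+j∣≤∣i∣+∣j∣ z₁ z₂) (ℕ.+-mono-≤ ∣z₁∣≤a ∣z₂∣≤b) ,
  subst (+ N ∣_) (regroup (+ toℕ i) (+ toℕ j) (+ toℕ k) z₁ z₂) (∣m∣n⇒∣m+n N∣₂ N∣₁)
  where
  regroup : ∀ i j k z₁ z₂ → (k - j - z₂) ℤ.+ (j - i - z₁) ≡ k - i - (z₁ ℤ.+ z₂)
  regroup = solve-∀

cycAdj-displacement : ∀ {N} {i j : Fin N} → CycAdj N i j → + N ∣ (+ toℕ j - + toℕ i - + 1)
cycAdj-displacement {N} {i} (inj₁ e) =
  subst (λ n → + N ∣ (+ n - + toℕ i - + 1)) e (divides (+ 0) (step-up (+ toℕ i) (+ N)))
  where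
  step-up : ∀ x n → (+ 1 ℤ.+ x) - x - + 1 ≡ + 0 ℤ.* n
  step-up = solve-∀
cycAdj-displacement {N} {i} {j} (inj₂ (wrap , j≡0)) =
  subst (λ n → + n ∣ (+ toℕ j - + toℕ i - + 1)) wrap
    (subst (λ n → + suc (toℕ i) ∣ (+ n - + toℕ i - + 1)) (sym j≡0)
      (divides (- + 1) (wrap-around (+ toℕ i))))
  where
  wrap-around : ∀ x → + 0 - x - + 1 ≡ - + 1 ℤ.* (+ 1 ℤ.+ x)
  wrap-around = solve-∀

adj-displacement : ∀ {N} {i j : Fin N} → Adj (Cycle N) i j → Displacement N 1 i j
adj-displacement (inj₁ a) = + 1 , ℕ.≤-refl , cycAdj-displacement a
adj-displacement {N} {i} {j} (inj₂ a) =
  - + 1 , ℕ.≤-refl , subst (+ N ∣_) (negate (+ toℕ i) (+ toℕ j)) (∣m⇒∣-m (cycAdj-displacement a))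
  where
  negate : ∀ i j → - (i - j - + 1) ≡ j - i - - + 1
  negate = solve-∀

walk-displacement : ∀ {N b} {i j : Fin N} → Walk (Cycle N) i j b → Displacement N b i j
walk-displacement {i = i} here = displacement-refl i
walk-displacement {i = i} {j} (step {y = y} a w) =
  displacement-++ {i = i} {y} {j} (adj-displacement a) (walk-displacement w)

Layer : ∀ {N} → ℕ → Fin N → Set
Layer e t = Σ ℕ λ q → toℕ t ≡ e + q * 6

layer⇒∣ : ∀ {N e} {t : Fin N} → Layer e t → + 6 ∣ (+ toℕ t - + e)
layer⇒∣ {e = e} (q , t≡e+6q) =
  subst (λ n → + 6 ∣ (+ n - + e)) (sym t≡e+6q)
    (divides (+ q) (trans (cancel (+ e) (+ (q * 6))) (ℤ.pos-* q 6)))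
  where
  cancel : ∀ e x → (e ℤ.+ x) - e ≡ x
  cancel = solve-∀

6∣6K : ∀ K → + 6 ∣ + (6 * K)
6∣6K K = divides (+ K) (trans (ℤ.pos-* 6 K) (ℤ.*-comm (+ 6) (+ K)))

layer-gap : ∀ {K b e e′} {s t : Fin (6 * K)} → Walk (Cycle (6 * K)) s t b →
            Layer e s → Layer e′ t → 2 * ∣ + e′ - + e ∣ ≤ 6 → ∣ + e′ - + e ∣ ≤ b
layer-gap {K} {e = e} {e′} {s} {t} w ls lt small with walk-displacement w
... | z , ∣z∣≤b , N∣t-s-z = ℕ.≤-trans (residue-gap (+ e′ - + e) z 6∣e′-e-z small) ∣z∣≤b
  where
  regroup : ∀ s t z e e′ → (t - s - z) - (t - e′) ℤ.+ (s - e) ≡ e′ - e - z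
  regroup = solve-∀
  6∣e′-e-z : + 6 ∣ (+ e′ - + e - z)
  6∣e′-e-z = subst (+ 6 ∣_) (regroup (+ toℕ s) (+ toℕ t) z (+ e) (+ e′))
    (∣m∣n⇒∣m+n (∣m∣n⇒∣m-n (∣-trans (6∣6K K) N∣t-s-z) (layer⇒∣ lt)) (layer⇒∣ ls))

same-layer⇒≡ : ∀ {K b e} {s t : Fin (6 * K)} → Walk (Cycle (6 * K)) s t b → b < 6 →
               Layer e s → Layer e t → s ≡ t
same-layer⇒≡ {K} {e = e} {s} {t} w b<6 ls lt with walk-displacement w
... | z , ∣z∣≤b , N∣t-s-z = ∣-difference⇒≡ (subst (+ (6 * K) ∣_) t-s-z≡t-s N∣t-s-z)
  where
  regroup : ∀ s t z e → (t - e) - (s - e) - (t - s - z) ≡ z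
  regroup = solve-∀
  z≡0 : z ≡ + 0
  z≡0 = small-multiple≡0
    (subst (+ 6 ∣_) (regroup (+ toℕ s) (+ toℕ t) z (+ e))
      (∣m∣n⇒∣m-n (∣m∣n⇒∣m-n (layer⇒∣ lt) (layer⇒∣ ls)) (∣-trans (6∣6K K) N∣t-s-z)))
    (ℕ.≤-<-trans ∣z∣≤b b<6)
  t-s-z≡t-s : + toℕ t - + toℕ s - z ≡ + toℕ t - + toℕ s
  t-s-z≡t-s = trans (cong (λ z → + toℕ t - + toℕ s - z) z≡0) (ℤ.+-identityʳ _)

layer-near : ∀ {K} (t : Fin (6 * K)) →
             Σ (Fin (6 * K)) λ t′ → DistLE (Cycle (6 * K)) t t′ 1 × (Layer 0 t′ ⊎ Layer 3 t′)
layer-near {suc k} t with toℕ t divMod 6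
... | result q 0F t≡6q   = t , distLE-refl , inj₁ (q , t≡6q)
... | result q 1F t≡1+6q = prev t , adj⇒distLE (adj-prev t) , inj₁ (q , toℕ-prev t t≡1+6q)
... | result q 2F t≡2+6q = next t , adj⇒distLE (inj₁ (next-spec t)) , inj₂ (q , up-to-3)
  where
  3+6q≢6K : 3 + q * 6 ≢ 6 * suc k
  3+6q≢6K eq = contradiction
    (trans (sym ([m+kn]%n≡m%n 3 q 6)) (trans (cong (_% 6) eq)
      (trans (cong (_% 6) (ℕ.*-comm 6 (suc k))) (m*n%n≡0 (suc k) 6))))
    (λ ())
  up-to-3 : toℕ (next t) ≡ 3 + q * 6
  up-to-3 with next-spec t
  ... | inj₁ e        = trans (sym e) (cong suc t≡2+6q)
  ... | inj₂ (wrap , _) = contradiction (trans (cong suc (sym t≡2+6q)) wrap) 3+6q≢6K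
... | result q 3F t≡3+6q = t , distLE-refl , inj₂ (q , t≡3+6q)
... | result q 4F t≡4+6q = prev t , adj⇒distLE (adj-prev t) , inj₂ (q , toℕ-prev t t≡4+6q)
... | result q 5F t≡5+6q = next t , adj⇒distLE (inj₁ (next-spec t)) , inj₁ up-to-0
  where
  up-to-0 : Layer 0 (next t)
  up-to-0 with next-spec t
  ... | inj₁ e          = suc q , trans (sym e) (cong suc t≡5+6q)
  ... | inj₂ (_ , next≡0) = 0 , next≡0

record Shift (G : Graph) : Set where
  field
    σ σ⁻¹    : V G → V G
    σ-hom    : Homomorphism G G σ
    σ⁻¹-hom  : Homomorphism G G σ⁻¹
    σ∘σ⁻¹    : ∀ x → σ (σ⁻¹ x) ≡ x
    σ⁻¹∘σ    : ∀ x → σ⁻¹ (σ x) ≡ x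
    walk-σ   : ∀ x → Walk G x (σ x) 2
    σ-far    : ∀ x {ℓ} → ℓ ≤ 1 → ¬ Walk G (σ x) x ℓ
    σ²≢id    : ∀ x → σ (σ x) ≢ x

  σ-injective : ∀ {x y} → σ x ≡ σ y → x ≡ y
  σ-injective {x} {y} σx≡σy = trans (sym (σ⁻¹∘σ x)) (trans (cong σ⁻¹ σx≡σy) (σ⁻¹∘σ y))

module ShiftedLayers {G : Graph} (undirected : Undirected G) (shift : Shift G) (x₀ : V G)
                     (D : Code G) (perfect : Perfect G 2 D) (k : ℕ) where

  open Shift shift

  N : ℕ
  N = 6 * suc k

  H : Graph
  H = G □ Cycle N

  code : Code H
  code (x , t) = (Layer 0 t × D x) ⊎ (Layer 3 t × D (σ x))

  codewords-far : ∀ {x y ℓ} → D x → D y → x ≢ y → Walk G x y ℓ → ℓ ≤ 4 → ⊥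
  codewords-far dx dy x≢y w ℓ≤4 = proj₁ perfect _ _ dx dy x≢y (_ , ℓ≤4 , w)

  across-far : ∀ {x y s t} → Layer 0 s → D x → Layer 3 t → D (σ y) → ¬ DistLE H (x , s) (y , t) 4
  across-far {x} {y} ls dx lt dσy d with □-split d
  ... | a , b , a+b≤4 , wG , wC =
    codewords-far dx dσy x≢σy (wG ++ʷ walk-σ y) (ℕ.m≤n⇒m≤1+n (ℕ.+-monoˡ-≤ 2 a≤1))
    where
    a≤1 : a ≤ 1
    a≤1 = m+n≤o+p∧p≤n⇒m≤o a+b≤4 (layer-gap {suc k} wC ls lt ℕ.≤-refl)
    x≢σy : x ≢ σ y
    x≢σy x≡σy = σ-far y a≤1 (subst (λ v → Walk G v y a) x≡σy wG)

  errorCorrecting : ErrorCorrecting H 2 code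
  errorCorrecting (x , s) (y , t) (inj₁ (ls , dx)) (inj₁ (lt , dy)) p≢q d with □-split d
  ... | a , b , a+b≤4 , wG , wC =
    codewords-far dx dy (λ x≡y → p≢q (cong₂ _,_ x≡y s≡t)) wG (ℕ.m+n≤o⇒m≤o a a+b≤4)
    where
    s≡t : s ≡ t
    s≡t = same-layer⇒≡ {suc k} wC (s≤s (ℕ.m≤n⇒m≤1+n (ℕ.m+n≤o⇒n≤o a a+b≤4))) ls lt
  errorCorrecting (x , s) (y , t) (inj₂ (ls , dσx)) (inj₂ (lt , dσy)) p≢q d with □-split d
  ... | a , b , a+b≤4 , wG , wC =
    codewords-far dσx dσy (λ σx≡σy → p≢q (cong₂ _,_ (σ-injective σx≡σy) s≡t))
                  (mapʷ σ σ-hom wG) (ℕ.m+n≤o⇒m≤o a a+b≤4)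
    where
    s≡t : s ≡ t
    s≡t = same-layer⇒≡ {suc k} wC (s≤s (ℕ.m≤n⇒m≤1+n (ℕ.m+n≤o⇒n≤o a a+b≤4))) ls lt
  errorCorrecting (x , s) (y , t) (inj₁ (ls , dx)) (inj₂ (lt , dσy)) _ d =
    across-far {x} {y} {s} {t} ls dx lt dσy d
  errorCorrecting (x , s) (y , t) (inj₂ (ls , dσx)) (inj₁ (lt , dy)) _ d =
    across-far {y} {x} {t} {s} lt dy ls dσx
      (distLE-reverse (□-undirected undirected cycle-undirected) d)

  covers-on-layers : ∀ x {t} → Layer 0 t ⊎ Layer 3 t → Σ (V H) λ c → code c × DistLE H (x , t) c 2
  covers-on-layers x {t} (inj₁ lt) with proj₁ (proj₂ perfect) x
  ... | c , dc , ℓ , ℓ≤2 , w = (c , t) , inj₁ (lt , dc) , ℓ , ℓ≤2 , □-walkˡ t w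
  covers-on-layers x {t} (inj₂ lt) with proj₁ (proj₂ perfect) (σ x)
  ... | c , dc , ℓ , ℓ≤2 , w =
    (σ⁻¹ c , t) , inj₂ (lt , subst D (sym (σ∘σ⁻¹ c)) dc) , ℓ , ℓ≤2 ,
    □-walkˡ t (subst (λ v → Walk G v (σ⁻¹ c) ℓ) (σ⁻¹∘σ x) (mapʷ σ⁻¹ σ⁻¹-hom w))

  covers : Covers H code 3
  covers (x , t) with layer-near {suc k} t
  ... | t′ , (ℓ , ℓ≤1 , w) , layer with covers-on-layers x layer
  ... | c , cc , d = c , cc , distLE-++ (ℓ , ℓ≤1 , □-walkʳ x w) d

  1<N : 1 < N
  1<N = ℕ.≤-trans (s≤s (s≤s z≤n)) (ℕ.m≤m*n 6 (suc k))

  t₁ : Fin N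
  t₁ = fromℕ< 1<N

  layer₁ : Layer 1 t₁
  layer₁ = 0 , toℕ-fromℕ< 1<N

  uncovered : ∀ {c q} → D c → code q → ¬ DistLE H (σ c , t₁) q 2
  uncovered {c} {y , t} dc (inj₁ (lt , dy)) d with □-split d
  ... | a , b , a+b≤2 , wG , wC =
    codewords-far dc dy c≢y (walk-σ c ++ʷ wG) (ℕ.+-monoʳ-≤ 2 (ℕ.m≤n⇒m≤1+n a≤1))
    where
    a≤1 : a ≤ 1
    a≤1 = m+n≤o+p∧p≤n⇒m≤o a+b≤2 (layer-gap {suc k} wC layer₁ lt (ℕ.m≤m+n 2 4))
    c≢y : c ≢ y
    c≢y c≡y = σ-far c a≤1 (subst (λ v → Walk G (σ c) v a) (sym c≡y) wG)
  uncovered {c} {y , t} dc (inj₂ (lt , dσy)) d with □-split d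
  ... | a , b , a+b≤2 , wG , wC =
    codewords-far dc (subst (λ v → D (σ v)) (sym σc≡y) dσy) (λ c≡σσc → σ²≢id c (sym c≡σσc))
                  (walk-σ c ++ʷ walk-σ (σ c)) ℕ.≤-refl
    where
    a≡0 : a ≡ 0
    a≡0 = ℕ.n≤0⇒n≡0 (m+n≤o+p∧p≤n⇒m≤o a+b≤2 (layer-gap {suc k} wC layer₁ lt (ℕ.m≤m+n 4 2)))
    σc≡y : σ c ≡ y
    σc≡y = walk₀⇒≡ (subst (Walk G (σ c) y) a≡0 wG)

  not-covers : ¬ Covers H code 2
  not-covers cover with proj₁ (proj₂ perfect) x₀
  ... | c , dc , _ with cover (σ c , t₁)
  ... | q , cq , d = uncovered dc cq d

  quasiPerfect : QuasiPerfect H 2 code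
  quasiPerfect = errorCorrecting , covers , not-covers

diagonal-shift : ∀ {m n} → 3 ≤ m → 2 ≤ n → Shift (Cycle m □ Cycle n)
diagonal-shift {suc m} {suc n} 3≤m 2≤n = record
  { σ        = λ (a , b) → prev a , prev b
  ; σ⁻¹      = λ (a , b) → next a , next b
  ; σ-hom    = □-hom {G′ = Cycle (suc m)} {H′ = Cycle (suc n)} prev-hom prev-hom
  ; σ⁻¹-hom  = □-hom {G′ = Cycle (suc m)} {H′ = Cycle (suc n)} next-hom next-hom
  ; σ∘σ⁻¹    = λ (a , b) → cong₂ _,_ (prev-next a) (prev-next b)
  ; σ⁻¹∘σ    = λ (a , b) → cong₂ _,_ (next-prev a) (next-prev b)
  ; walk-σ   = λ (a , b) → step (inj₁ (refl , adj-prev a)) (step (inj₂ (refl , adj-prev b)) here)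
  ; σ-far    = far
  ; σ²≢id    = λ (a , b) σ²≡id → prev²≢ 3≤m a (cong proj₁ σ²≡id)
  }
  where
  far : ∀ x {ℓ} → ℓ ≤ 1 → ¬ Walk (Cycle (suc m) □ Cycle (suc n)) (prev (proj₁ x) , prev (proj₂ x)) x ℓ
  far (a , b) z≤n       w = prev≢ (ℕ.<⇒≤ 3≤m) a (cong proj₁ (walk₀⇒≡ w))
  far (a , b) (s≤s z≤n) w with walk₁⇒adj w
  ... | inj₁ (prev-b≡b , _) = prev≢ 2≤n b prev-b≡b
  ... | inj₂ (prev-a≡a , _) = prev≢ (ℕ.<⇒≤ 3≤m) a prev-a≡a

corollary3 : (m n : ℕ) → 3 ≤ m → 3 ≤ n →
    Σ (Code (Cycle m □ Cycle n)) (Perfect (Cycle m □ Cycle n) 2) →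
    (k : ℕ) → 1 ≤ k →
    Σ (Code ((Cycle m □ Cycle n) □ Cycle (6 * k)))
      (QuasiPerfect ((Cycle m □ Cycle n) □ Cycle (6 * k)) 2)
corollary3 m n 3≤m@(s≤s _) 3≤n@(s≤s _) (D , perfect) k (s≤s _) = code , quasiPerfect
  where
  open ShiftedLayers (□-undirected cycle-undirected cycle-undirected)
                     (diagonal-shift 3≤m (ℕ.<⇒≤ 3≤n)) (zero , zero) D perfect _
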